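{- Let $G$ be a symmetric even graph with vertex set $V$. A nonempty set $A\subseteq V$ is a center set of $G$ if and only if either $A=V$ or there is no vertex $x\in V$ with $\{x\}\cup N(x)\subseteq A$.
   Context: $G$ is finite, simple, connected; $d$ is shortest-path distance, $\mathrm{diam}(G)=\max_{u,v}d(u,v)$, and $N(x)$ is the set of neighbours of $x$. $G$ is even if for each vertex $u$ there is a unique vertex $\bar u$ with $d(u,\bar u)=\mathrm{diam}(G)$; an even graph is symmetric if $d(u,v)+d(u,\bar v)=\mathrm{diam}(G)$ for all $u,v\in V$. For nonempty $S\subseteq V$, $e_S(v)=\max_{x\in S}d(v,x)$ and $C_S(G)=\{v\in V: e_S(v)\le e_S(x)\ \forall x\in V\}$. A set $A\subseteq V$ is a center set of $G$ if $A=C_S(G)$ for some nonempty $S\subseteq V$. -}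

module Defs where

open import Data.Nat using (ℕ; zero; suc; _+_; _≤_; _⊔_)
open import Data.Bool using (Bool; true; false; _∨_; _∧_; if_then_else_; T)
open import Data.Fin using (Fin; zero; suc; _≟_)
open import Data.Fin.Subset using (Subset; Side; inside; outside; _∈_; ⊤; Nonempty)
open import Data.Vec using (lookup)
open import Data.Product using (Σ; _×_; ∃)
open import Data.Sum using (_⊎_)
open import Relation.Nullary using (¬_)
open import Relation.Nullary.Decidable using (⌊_⌋)
open import Relation.Binary.PropositionalEquality using (_≡_)
open import Function.Bundles using (_⇔_)

record Graph (n : ℕ) : Set where
  field
    adj    : Fin n → Fin n → Bool
    adjSym : ∀ u v → adj u v ≡ adj v u
    irrefl : ∀ u → adj u u ≡ false

module _ {n : ℕ} (G : Graph n) where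
  open Graph G

  Adj : Fin n → Fin n → Set
  Adj x y = T (adj x y)

  data Walk : Fin n → Fin n → Set where
    here : ∀ {u} → Walk u u
    step : ∀ {u w v} → Adj u w → Walk w v → Walk u v

  Connected : Set
  Connected = ∀ u v → Walk u v

  anyV : ∀ {m} → (Fin m → Bool) → Bool
  anyV {zero} f = false
  anyV {suc m} f = f zero ∨ anyV (λ i → f (suc i))

  reach : ℕ → Fin n → Fin n → Bool
  reach zero u v = ⌊ u ≟ v ⌋
  reach (suc k) u v = reach k u v ∨ anyV (λ w → reach k u w ∧ adj w v)

  findDist : Fin n → Fin n → ℕ → ℕ → ℕ
  findDist u v k zero = k
  findDist u v k (suc f) = if reach k u v then k else findDist u v (suc k) f

  -- shortest-path distance d(u,v): the least k such that a walk of length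
  -- ≤ k joins u and v (searched among 0..n; in a connected graph it is < n)
  dist : Fin n → Fin n → ℕ
  dist u v = findDist u v 0 n

  maxV : ∀ {m} → (Fin m → ℕ) → ℕ
  maxV {zero} f = 0
  maxV {suc m} f = f zero ⊔ maxV (λ i → f (suc i))

  diam : ℕ
  diam = maxV (λ u → maxV (λ v → dist u v))

  Even : Set
  Even = ∀ u → Σ (Fin n) λ ū → dist u ū ≡ diam × (∀ w → dist u w ≡ diam → w ≡ ū)

  Symmetric : Set
  Symmetric = ∀ u v v̄ → dist v v̄ ≡ diam → dist u v + dist u v̄ ≡ diam

  -- contribution of x to e_S(v): d(v,x) if x ∈ S, else 0 (distances are ≥ 0)
  distIf : Side → ℕ → ℕ
  distIf inside d = d
  distIf outside d = 0

  ecc : Subset n → Fin n → ℕ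
  ecc S v = maxV (λ x → distIf (lookup S x) (dist v x))

  InCenter : Subset n → Fin n → Set
  InCenter S v = ∀ x → ecc S v ≤ ecc S x

  IsCenterSet : Subset n → Set
  IsCenterSet A = Σ (Subset n) λ S → Nonempty S × (∀ v → (v ∈ A ⇔ InCenter S v))

  ClosedNbhdIn : Fin n → Subset n → Set
  ClosedNbhdIn x A = x ∈ A × (∀ y → Adj x y → y ∈ A)

-- In an even graph write v̄ for the antipode of v. Symmetry says d(u,s) = diam − d(u,s̄), so
-- e_S(u) = diam − min over s ∈ S of d(u,s̄): the centre C_S consists of the vertices farthest
-- from S̄ = {s̄ : s ∈ S}.  If a vertex x and all its neighbours are central, then x is at
-- distance 0 from S̄ (a neighbour one step closer to s̄ would be strictly farther from s), so
-- e_S(x) = diam and everything is central.  Conversely, if every vertex of A ≠ V has a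
-- neighbour outside A, take S = {s : s̄ ∉ A}: vertices outside A have eccentricity diam,
-- vertices of A have eccentricity exactly diam − 1.
module Submission where

open import Defs
open import Data.Nat using (ℕ; zero; suc; _+_; _≤_; _<_; _≤′_; ≤′-reflexive; ≤′-step; _≤?_; z≤n; s≤s)
open import Data.Nat.Properties
  using (≤-refl; ≤-trans; ≤-reflexive; ≤-pred; <⇒≤; <⇒≱; <-irrefl; ≰⇒>; ≤⇒≤′; n≤0⇒n≡0;
         m≤n⇒m<n∨m≡n; m<n⇒m<1+n; m<m+n; m≤n⇒m≤1+n; +-identityʳ; +-suc; +-mono-≤; +-monoʳ-<; n<1+n;
         m≤m⊔n; m≤n⊔m; ⊔-lub; ⊔-sel; ⊔-identityʳ; module ≤-Reasoning)
open import Data.Bool using (Bool; true; false; T)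
open import Data.Bool.Properties using (T-≡; T-∨; T-∧)
open import Data.Empty using (⊥-elim)
open import Data.Fin using (Fin; zero; suc)
open import Data.Fin.Properties using (all?; ¬∀⟶∃¬)
open import Data.Fin.Subset using (Subset; ⊤; Nonempty; _∈_; _∉_; _⊆_; _⊈_; ∣_∣)
open import Data.Fin.Subset.Properties using (_∈?_; _⊆?_; ∈⊤; ⊆⊤; ⊥⊆; ∉⊥; ∣⊥∣≡0; ∣p∣≤n; p⊂q⇒∣p∣<∣q∣; ⊆-antisym)
open import Data.Vec using (lookup; tabulate)
open import Data.Vec.Properties using ([]=⇒lookup; lookup⇒[]=; lookup∘tabulate)
open import Data.Product using (∃; _×_; _,_; proj₁; proj₂)
open import Data.Sum using (_⊎_; inj₁; inj₂)
open import Relation.Nullary using (¬_; yes; no; contradiction)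
open import Relation.Nullary.Decidable using (⌊_⌋; ¬?; T?; _→-dec_; toWitness; fromWitness; decidable-stable)
open import Relation.Binary.PropositionalEquality using (_≡_; refl; sym; trans; cong; subst)
open import Function.Base using (_∘_)
open import Function.Bundles using (_⇔_; mk⇔; Equivalence)

open Equivalence using (to; from)

∈-tabulate⁺ : ∀ {n} {f : Fin n → Bool} {x} → T (f x) → x ∈ tabulate f
∈-tabulate⁺ {f = f} {x} t = lookup⇒[]= x (tabulate f) (trans (lookup∘tabulate f x) (to T-≡ t))

∈-tabulate⁻ : ∀ {n} {f : Fin n → Bool} {x} → x ∈ tabulate f → T (f x)
∈-tabulate⁻ {f = f} {x} p = from T-≡ (trans (sym (lookup∘tabulate f x)) ([]=⇒lookup p))

⊈⇒∃ : ∀ {n} {p q : Subset n} → p ⊈ q → ∃ λ x → x ∈ p × x ∉ q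
⊈⇒∃ {n} {p} {q} p⊈q with ¬∀⟶∃¬ n (λ x → x ∈ p → x ∈ q) (λ x → (x ∈? p) →-dec (x ∈? q)) (λ h → p⊈q (h _))
... | x , ¬x∈p⇒x∈q =
  x , decidable-stable (x ∈? p) (λ x∉p → ¬x∈p⇒x∈q (λ x∈p → contradiction x∈p x∉p))
    , (λ x∈q → ¬x∈p⇒x∈q (λ _ → x∈q))

module _ {n : ℕ} (G : Graph n) where
  open Graph G

  anyV⁺ : ∀ {m} {f : Fin m → Bool} i → T (f i) → T (anyV G f)
  anyV⁺ zero t = from T-∨ (inj₁ t)
  anyV⁺ {f = f} (suc i) t = from T-∨ (inj₂ (anyV⁺ {f = λ j → f (suc j)} i t))

  anyV⁻ : ∀ {m} {f : Fin m → Bool} → T (anyV G f) → ∃ λ i → T (f i)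
  anyV⁻ {zero} ()
  anyV⁻ {suc m} t with to T-∨ t
  ... | inj₁ t₀ = zero , t₀
  ... | inj₂ t₊ = let i , tᵢ = anyV⁻ t₊ in suc i , tᵢ

  maxV-upper : ∀ {m} (f : Fin m → ℕ) i → f i ≤ maxV G f
  maxV-upper f zero = m≤m⊔n _ _
  maxV-upper f (suc i) = ≤-trans (maxV-upper (λ j → f (suc j)) i) (m≤n⊔m (f zero) _)

  maxV-least : ∀ {m} (f : Fin m → ℕ) {b} → (∀ i → f i ≤ b) → maxV G f ≤ b
  maxV-least {zero} f h = z≤n
  maxV-least {suc m} f h = ⊔-lub (h zero) (maxV-least (λ j → f (suc j)) (λ j → h (suc j)))

  maxV-attained : ∀ {m} (f : Fin m → ℕ) → Fin m → ∃ λ i → f i ≡ maxV G f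
  maxV-attained {suc zero} f _ = zero , sym (⊔-identityʳ (f zero))
  maxV-attained {suc (suc m)} f _
    with maxV-attained (λ j → f (suc j)) zero | ⊔-sel (f zero) (maxV G (λ j → f (suc j)))
  ... | _ | inj₁ e = zero , sym e
  ... | i , fᵢ≡max | inj₂ e = suc i , trans fᵢ≡max (sym e)

  -- Wrapped in a record (and `ball` below kept opaque) so that k, u and v can be inferred
  -- from the type: `reach` itself is not injective.
  record Reach (k : ℕ) (u v : Fin n) : Set where
    constructor reached
    field reached⁻¹ : T (reach G k u v)

  ¬Reach : ∀ {k u v} → reach G k u v ≡ false → ¬ Reach k u v
  ¬Reach e (reached r) = subst T e r

  reach-zero : ∀ {u v} → Reach 0 u v → u ≡ v
  reach-zero (reached r) = toWitness r

  reach-suc : ∀ {k u v} → Reach k u v → Reach (suc k) u v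
  reach-suc (reached r) = reached (from T-∨ (inj₁ r))

  reach-refl : ∀ k u → Reach k u u
  reach-refl zero u = reached (fromWitness refl)
  reach-refl (suc k) u = reach-suc (reach-refl k u)

  reach-mono : ∀ {j k u v} → j ≤ k → Reach j u v → Reach k u v
  reach-mono j≤k = go (≤⇒≤′ j≤k)
    where
      go : ∀ {j k u v} → j ≤′ k → Reach j u v → Reach k u v
      go (≤′-reflexive refl) r = r
      go (≤′-step j≤′k) r = reach-suc (go j≤′k r)

  reach-snoc : ∀ {k u w v} → Reach k u w → Adj G w v → Reach (suc k) u v
  reach-snoc {w = w} (reached r) a = reached (from T-∨ (inj₂ (anyV⁺ w (from T-∧ (r , a)))))

  reach-unsnoc : ∀ {k u v} → Reach (suc k) u v → Reach k u v ⊎ ∃ λ w → Reach k u w × Adj G w v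
  reach-unsnoc (reached r) with to T-∨ r
  ... | inj₁ r′ = inj₁ (reached r′)
  ... | inj₂ r′ = let w , rw = anyV⁻ r′ ; rᵤ , a = to T-∧ rw in inj₂ (w , reached rᵤ , a)

  reach-cons : ∀ {k u w v} → Adj G u w → Reach k w v → Reach (suc k) u v
  reach-cons {zero} a r with reach-zero r
  ... | refl = reach-snoc (reach-refl 0 _) a
  reach-cons {suc k} a r with reach-unsnoc r
  ... | inj₁ r′ = reach-suc (reach-cons a r′)
  ... | inj₂ (_ , r′ , b) = reach-snoc (reach-cons a r′) b

  reach-uncons : ∀ {k u v} → Reach (suc k) u v → u ≡ v ⊎ ∃ λ w → Adj G u w × Reach k w v
  reach-uncons {zero} r with reach-unsnoc r
  ... | inj₁ r′ = inj₁ (reach-zero r′)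
  ... | inj₂ (_ , r′ , b) with reach-zero r′
  ...   | refl = inj₂ (_ , b , reach-refl 0 _)
  reach-uncons {suc k} r with reach-unsnoc r
  ... | inj₁ r′ with reach-uncons r′
  ...   | inj₁ u≡v = inj₁ u≡v
  ...   | inj₂ (w , a , r″) = inj₂ (w , a , reach-suc r″)
  reach-uncons {suc k} r | inj₂ (_ , r′ , b) with reach-uncons r′
  ...   | inj₁ refl = inj₂ (_ , b , reach-refl (suc k) _)
  ...   | inj₂ (w , a , r″) = inj₂ (w , a , reach-snoc r″ b)

  walk⇒reach : ∀ {u v} → Walk G u v → ∃ λ k → Reach k u v
  walk⇒reach here = 0 , reach-refl 0 _
  walk⇒reach (step a w) = let k , r = walk⇒reach w in suc k , reach-cons a r

  opaque
    ball : ℕ → Fin n → Subset n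
    ball k u = tabulate (reach G k u)

    ∈-ball⁺ : ∀ {k u v} → Reach k u v → v ∈ ball k u
    ∈-ball⁺ (reached r) = ∈-tabulate⁺ r

    ∈-ball⁻ : ∀ {k u v} → v ∈ ball k u → Reach k u v
    ∈-ball⁻ v∈ball = reached (∈-tabulate⁻ v∈ball)

  Stable : Fin n → ℕ → Set
  Stable u k = ball (suc k) u ⊆ ball k u

  stable-suc : ∀ {u k} → Stable u k → Stable u (suc k)
  stable-suc st v∈ball with reach-unsnoc (∈-ball⁻ v∈ball)
  ... | inj₁ r = ∈-ball⁺ r
  ... | inj₂ (_ , r , a) = ∈-ball⁺ (reach-snoc (∈-ball⁻ (st (∈-ball⁺ r))) a)

  stable-mono : ∀ {u i k} → Stable u i → i ≤′ k → Stable u k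
  stable-mono st (≤′-reflexive refl) = st
  stable-mono st (≤′-step i≤′k) = stable-suc (stable-mono st i≤′k)

  ball-stable : ∀ {u i k} → Stable u i → i ≤′ k → ball k u ⊆ ball i u
  ball-stable st (≤′-reflexive refl) v∈ball = v∈ball
  ball-stable st (≤′-step i≤′k) v∈ball = ball-stable st i≤′k (stable-mono st i≤′k v∈ball)

  ball-grows : ∀ u k → (∃ λ i → i < k × Stable u i) ⊎ k < ∣ ball k u ∣
  ball-grows u zero =
    inj₂ (subst (_< ∣ ball 0 u ∣) (∣⊥∣≡0 n) (p⊂q⇒∣p∣<∣q∣ (⊥⊆ , u , ∈-ball⁺ (reach-refl 0 u) , ∉⊥)))
  ball-grows u (suc k) with ball-grows u k
  ... | inj₁ (i , i<k , st) = inj₁ (i , m<n⇒m<1+n i<k , st)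
  ... | inj₂ k<∣ball∣ with ball (suc k) u ⊆? ball k u
  ...   | yes st = inj₁ (k , ≤-refl , st)
  ...   | no ¬st = inj₂ (≤-trans (s≤s k<∣ball∣) (p⊂q⇒∣p∣<∣q∣ ((∈-ball⁺ ∘ reach-suc ∘ ∈-ball⁻) , ⊈⇒∃ ¬st)))

  -- `dist` only searches walk lengths below n: the balls around u grow strictly until they
  -- stabilise, and cannot grow n times.
  stabilises : ∀ u → ∃ λ i → i < n × Stable u i
  stabilises u with ball-grows u n
  ... | inj₁ s = s
  ... | inj₂ n<∣ball∣ = contradiction (∣p∣≤n (ball n u)) (<⇒≱ n<∣ball∣)

  reach-below : ∀ {k u v} → Reach k u v → ∃ λ i → i < n × Reach i u v
  reach-below {k} {u} r with stabilises u
  ... | i , i<n , st with k ≤? i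
  ...   | yes k≤i = i , i<n , reach-mono k≤i r
  ...   | no k≰i = i , i<n , ∈-ball⁻ (ball-stable st (≤⇒≤′ (<⇒≤ (≰⇒> k≰i))) (∈-ball⁺ r))

  findDist-least : ∀ {u v j} k f → k ≤ j → Reach j u v → findDist G u v k f ≤ j
  findDist-least k zero k≤j r = k≤j
  findDist-least {u} {v} {j} k (suc f) k≤j r with reach G k u v in e
  ... | true = k≤j
  ... | false with m≤n⇒m<n∨m≡n k≤j
  ...   | inj₁ k<j = findDist-least (suc k) f k<j r
  ...   | inj₂ refl = contradiction r (¬Reach e)

  findDist-sound : ∀ {u v j} k f → k ≤ j → j < k + f → Reach j u v →
                   Reach (findDist G u v k f) u v
  findDist-sound k zero k≤j j<k+0 r =
    contradiction (≤-trans (≤-reflexive (+-identityʳ k)) k≤j) (<⇒≱ j<k+0)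
  findDist-sound {u} {v} {j} k (suc f) k≤j j<k+1+f r with reach G k u v in e
  ... | true = reached (from T-≡ e)
  ... | false with m≤n⇒m<n∨m≡n k≤j
  ...   | inj₁ k<j = findDist-sound (suc k) f k<j (subst (j <_) (+-suc k f) j<k+1+f) r
  ...   | inj₂ refl = contradiction r (¬Reach e)

  dist-least : ∀ {u v j} → Reach j u v → dist G u v ≤ j
  dist-least = findDist-least 0 n z≤n

  dist-refl : ∀ u → dist G u u ≡ 0
  dist-refl u = n≤0⇒n≡0 (dist-least (reach-refl 0 u))

  Adj⇒dist≤1 : ∀ {u v} → Adj G u v → dist G u v ≤ 1
  Adj⇒dist≤1 a = dist-least (reach-snoc (reach-refl 0 _) a)

  dist≤diam : ∀ u v → dist G u v ≤ diam G
  dist≤diam u v = ≤-trans (maxV-upper (dist G u) v) (maxV-upper (λ w → maxV G (dist G w)) u)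

  module _ (conn : Connected G) where

    reach-dist : ∀ u v → Reach (dist G u v) u v
    reach-dist u v =
      let _ , r = walk⇒reach (conn u v)
          _ , i<n , rᵢ = reach-below r
      in findDist-sound 0 n z≤n i<n rᵢ

    dist≡0⇒≡ : ∀ {u v} → dist G u v ≡ 0 → u ≡ v
    dist≡0⇒≡ {u} {v} d≡0 = reach-zero (subst (λ k → Reach k u v) d≡0 (reach-dist u v))

    dist-step : ∀ {u v j} → dist G u v ≡ suc j → ∃ λ w → Adj G u w × dist G w v ≤ j
    dist-step {u} {v} d≡1+j with reach-uncons (subst (λ k → Reach k u v) d≡1+j (reach-dist u v))
    ... | inj₂ (w , a , r) = w , a , dist-least r
    ... | inj₁ refl = contradiction (trans (sym d≡1+j) (dist-refl u)) λ ()

  ecc-upper : ∀ S v {x} → x ∈ S → dist G v x ≤ ecc G S v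
  ecc-upper S v {x} x∈S =
    subst (λ b → distIf G b (dist G v x) ≤ ecc G S v) ([]=⇒lookup x∈S)
          (maxV-upper (λ y → distIf G (lookup S y) (dist G v y)) x)

  ecc≤diam : ∀ S v → ecc G S v ≤ diam G
  ecc≤diam S v = maxV-least _ bound
    where
      bound : ∀ x → distIf G (lookup S x) (dist G v x) ≤ diam G
      bound x with lookup S x
      ... | true = dist≤diam v x
      ... | false = z≤n

  ecc-attained : ∀ S v → Nonempty S → ∃ λ s → s ∈ S × dist G v s ≡ ecc G S v
  ecc-attained S v (s₀ , s₀∈S) with maxV-attained (λ y → distIf G (lookup S y) (dist G v y)) s₀
  ... | s , e with lookup S s in s∈S
  ...   | true = s , lookup⇒[]= s S s∈S , e
  ...   | false = s₀ , s₀∈S , trans (n≤0⇒n≡0 (≤-trans (ecc-upper S v s₀∈S) (≤-reflexive (sym e)))) e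

  ecc-< : ∀ S v {b} → 0 < b → (∀ {x} → x ∈ S → dist G v x < b) → ecc G S v < b
  ecc-< S v {b} 0<b h =
    let x , e = maxV-attained (λ y → distIf G (lookup S y) (dist G v y)) v in subst (_< b) e (term< x)
    where
      term< : ∀ x → distIf G (lookup S x) (dist G v x) < b
      term< x with lookup S x in x∈S
      ... | true = h (lookup⇒[]= x S x∈S)
      ... | false = 0<b

  noClosedNbhd⇒escape : ∀ {A} → ¬ (∃ λ x → ClosedNbhdIn G x A) → ∀ v → v ∈ A → ∃ λ y → Adj G v y × y ∉ A
  noClosedNbhd⇒escape {A} noClosed v v∈A
    with ¬∀⟶∃¬ n (λ y → Adj G v y → y ∈ A) (λ y → T? (adj v y) →-dec (y ∈? A))
               (λ N⊆A → noClosed (v , v∈A , N⊆A))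
  ... | y , ¬Adj⇒∈ =
    y , decidable-stable (T? (adj v y)) (λ ¬a → ¬Adj⇒∈ (λ a → contradiction a ¬a))
      , (λ y∈A → ¬Adj⇒∈ (λ _ → y∈A))

module _ {n : ℕ} {G : Graph n} (conn : Connected G) (even : Even G) (symmetric : Symmetric G) where

  antipode : Fin n → Fin n
  antipode v = proj₁ (even v)

  dist-antipode : ∀ v → dist G v (antipode v) ≡ diam G
  dist-antipode v = proj₁ (proj₂ (even v))

  dist+dist-antipode : ∀ u v → dist G u v + dist G u (antipode v) ≡ diam G
  dist+dist-antipode u v = symmetric u v (antipode v) (dist-antipode v)

  antipode-involutive : ∀ v → antipode (antipode v) ≡ v
  antipode-involutive v = sym (proj₂ (proj₂ (even (antipode v))) v dist≡diam)
    where
      dist≡diam : dist G (antipode v) v ≡ diam G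
      dist≡diam = trans (sym (trans (cong (dist G (antipode v) v +_) (dist-refl G (antipode v))) (+-identityʳ _)))
                        (dist+dist-antipode (antipode v) v)

  diam≤ecc-antipode : ∀ S v → antipode v ∈ S → diam G ≤ ecc G S v
  diam≤ecc-antipode S v v̄∈S = subst (_≤ ecc G S v) (dist-antipode v) (ecc-upper G S v v̄∈S)

  center-full-if-ecc≡diam : ∀ {S x} → InCenter G S x → ecc G S x ≡ diam G → ∀ w → InCenter G S w
  center-full-if-ecc≡diam {S} {x} x∈C e w y =
    ≤-trans (ecc≤diam G S w) (≤-trans (≤-reflexive (sym e)) (x∈C y))

  -- A neighbour of x one step closer to s̄ would be strictly farther from s than e_S(x).
  center-full-if-closedNbhd : ∀ {S x} → Nonempty S → InCenter G S x →
    (∀ y → Adj G x y → InCenter G S y) → ∀ w → InCenter G S w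
  center-full-if-closedNbhd {S} {x} S≠∅ x∈C N⊆C with ecc-attained G S x S≠∅
  ... | s , s∈S , dxs≡ecc with dist G x (antipode s) in dxs̄
  ...   | zero = center-full-if-ecc≡diam {S} x∈C
                   (trans (sym dxs≡ecc) (trans (sym (+-identityʳ _))
                     (trans (cong (dist G x s +_) (sym dxs̄)) (dist+dist-antipode x s))))
  ...   | suc j with dist-step G conn dxs̄
  ...     | y , a , dys̄≤j = ⊥-elim (<-irrefl refl (begin-strict
      diam G                                 ≡⟨ sym (dist+dist-antipode y s) ⟩
      dist G y s + dist G y (antipode s)     ≤⟨ +-mono-≤ dys≤dxs dys̄≤j ⟩
      dist G x s + j                         <⟨ +-monoʳ-< (dist G x s) (n<1+n j) ⟩
      dist G x s + suc j                     ≡⟨ cong (dist G x s +_) (sym dxs̄) ⟩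
      dist G x s + dist G x (antipode s)     ≡⟨ dist+dist-antipode x s ⟩
      diam G                                 ∎))
    where
      open ≤-Reasoning
      dys≤dxs : dist G y s ≤ dist G x s
      dys≤dxs = ≤-trans (ecc-upper G S y s∈S) (≤-trans (N⊆C y a x) (≤-reflexive (sym dxs≡ecc)))

  isCenterSet⇒full-or-noClosedNbhd : ∀ {A} → IsCenterSet G A → A ≡ ⊤ ⊎ ¬ (∃ λ x → ClosedNbhdIn G x A)
  isCenterSet⇒full-or-noClosedNbhd {A} (S , S≠∅ , A⇔C) with all? (_∈? A)
  ... | yes all∈A = inj₁ (⊆-antisym ⊆⊤ (λ {x} _ → all∈A x))
  ... | no ¬all∈A = inj₂ λ (x , x∈A , N⊆A) → ¬all∈A λ w →
    from (A⇔C w) (center-full-if-closedNbhd S≠∅ (to (A⇔C x) x∈A) (λ y a → to (A⇔C y) (N⊆A y a)) w)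

  ⊤-isCenterSet : Nonempty (⊤ {n}) → IsCenterSet G ⊤
  ⊤-isCenterSet V≠∅ = ⊤ , V≠∅ , λ v → mk⇔ (λ _ x → all-central v x) (λ _ → ∈⊤)
    where
      all-central : ∀ v x → ecc G ⊤ v ≤ ecc G ⊤ x
      all-central v x = ≤-trans (ecc≤diam G ⊤ v) (diam≤ecc-antipode ⊤ x ∈⊤)

  antipodesOutside : Subset n → Subset n
  antipodesOutside A = tabulate (λ x → ⌊ ¬? (antipode x ∈? A) ⌋)

  module _ {A : Subset n} (escapes : ∀ v → v ∈ A → ∃ λ y → Adj G v y × y ∉ A) where

    private
      S : Subset n
      S = antipodesOutside A

    antipode∈S : ∀ {y} → y ∉ A → antipode y ∈ S
    antipode∈S {y} y∉A = ∈-tabulate⁺ (fromWitness (subst (_∉ A) (sym (antipode-involutive y)) y∉A))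

    dist-inside-outside : ∀ {u w} → u ∈ A → w ∉ A → 1 ≤ dist G u w
    dist-inside-outside {u} {w} u∈A w∉A with dist G u w in d≡0
    ... | zero = contradiction (subst (_∈ A) (dist≡0⇒≡ G conn d≡0) u∈A) w∉A
    ... | suc _ = s≤s z≤n

    diam≤ecc-outside : ∀ {v} → v ∉ A → diam G ≤ ecc G S v
    diam≤ecc-outside {v} v∉A = diam≤ecc-antipode S v (antipode∈S v∉A)

    ecc<diam-inside : ∀ {v} → v ∈ A → ecc G S v < diam G
    ecc<diam-inside {v} v∈A = ecc-< G S v 0<diam dist<diam
      where
        0<diam : 0 < diam G
        0<diam = let y , _ , y∉A = escapes v v∈A in ≤-trans (dist-inside-outside v∈A y∉A) (dist≤diam G v y)
        dist<diam : ∀ {x} → x ∈ S → dist G v x < diam G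
        dist<diam {x} x∈S = begin-strict
          dist G v x                       <⟨ m<m+n (dist G v x) (dist-inside-outside v∈A (toWitness (∈-tabulate⁻ x∈S))) ⟩
          dist G v x + dist G v (antipode x) ≡⟨ dist+dist-antipode v x ⟩
          diam G                           ∎
          where open ≤-Reasoning

    diam≤1+ecc : ∀ w → diam G ≤ suc (ecc G S w)
    diam≤1+ecc w with w ∈? A
    ... | no w∉A = m≤n⇒m≤1+n (diam≤ecc-outside w∉A)
    ... | yes w∈A = let y , a , y∉A = escapes w w∈A in
      ≤-trans (≤-reflexive (sym (dist+dist-antipode w y)))
              (+-mono-≤ (Adj⇒dist≤1 G a) (ecc-upper G S w (antipode∈S y∉A)))

    antipodesOutside-isCenterSet : Nonempty A → IsCenterSet G A
    antipodesOutside-isCenterSet (a , a∈A) =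
      S , (let y , _ , y∉A = escapes a a∈A in antipode y , antipode∈S y∉A) , λ v → mk⇔ (central v) (inside v)
      where
        central : ∀ v → v ∈ A → InCenter G S v
        central v v∈A x = ≤-pred (≤-trans (ecc<diam-inside v∈A) (diam≤1+ecc x))
        inside : ∀ v → InCenter G S v → v ∈ A
        inside v v∈C with v ∈? A
        ... | yes v∈A = v∈A
        ... | no v∉A = contradiction (≤-trans (diam≤ecc-outside v∉A) (v∈C a)) (<⇒≱ (ecc<diam-inside a∈A))

mainTheorem11 : ∀ {n : ℕ} (G : Graph n) → Connected G → Even G → Symmetric G →
    (A : Subset n) → Nonempty A →
    (IsCenterSet G A ⇔ (A ≡ ⊤ ⊎ ¬ (∃ λ x → ClosedNbhdIn G x A)))
mainTheorem11 G conn even symmetric A A≠∅ =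
  mk⇔ (isCenterSet⇒full-or-noClosedNbhd conn even symmetric) isCenterSet
  where
    isCenterSet : A ≡ ⊤ ⊎ ¬ (∃ λ x → ClosedNbhdIn G x A) → IsCenterSet G A
    isCenterSet (inj₁ refl) = ⊤-isCenterSet conn even symmetric A≠∅
    isCenterSet (inj₂ noClosed) =
      antipodesOutside-isCenterSet conn even symmetric (noClosedNbhd⇒escape G noClosed) A≠∅
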